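{- For every spine $\mathbf{s}$ in $\{0,\ldots,n-1\}^k$ and every $j\in\{0,\ldots,(n-1)k\}$, the multi-dimensional herringbone function $h^{\mathbf{s},j}$ has a unique fixed point, namely $s^j$.
   Context: Order $\{0,\ldots,n-1\}^k$ componentwise; $a<b$ means $a\le b$ and $a\ne b$. A spine is a sequence $\mathbf{s}=(s^0,\ldots,s^{(n-1)k})$ of vertices with $s^0=(0,\ldots,0)$, $s^{(n-1)k}=(n-1,\ldots,n-1)$ and $s^{i+1}>s^i$ for all $i$. Define $M(v)=\min\{i\in\{0,\ldots,(n-1)k\}: s^i\ge v\}$, $\mu(v)=\max\{i: s^i\le v\}$, and $h^{\mathbf{s},j}:\{0,\ldots,n-1\}^k\to\{0,\ldots,n-1\}^k$ by $h^{\mathbf{s},j}(v)=v$ if $v=s^j$; $s^{i+1}$ if $v=s^i$, $i<j$; $s^{i-1}$ if $v=s^i$, $i>j$; and $v+(s^{\mu(v)+1}-s^{\mu(v)})-(s^{M(v)}-s^{M(v)-1})$ otherwise. -}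

module Defs where

open import Data.Nat as ℕ using (ℕ; zero; suc; _∸_; _*_; _⊔_; _⊓_)
open import Data.Nat.Properties as ℕP using ()
open import Data.Fin as Fin using (Fin; toℕ; fromℕ; inject₁)
open import Data.Fin.Properties as FinP using (any?)
open import Data.Vec as Vec using (Vec; lookup; zipWith)
open import Data.Vec.Properties using (≡-dec)
open import Data.Vec.Relation.Binary.Pointwise.Inductive as PW using (Pointwise)
open import Data.Integer as ℤ using (ℤ)
open import Data.List using (foldr; allFin)
open import Data.Bool using (if_then_else_)
open import Data.Product using (_×_; _,_)
open import Relation.Binary.PropositionalEquality using (_≡_; _≢_)
open import Relation.Nullary using (Dec; yes; no; does)

Vertex : ℕ → ℕ → Set
Vertex n k = Vec (Fin n) k

_≤ᵥ_ : ∀ {n k} → Vertex n k → Vertex n k → Set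
_≤ᵥ_ = Pointwise Fin._≤_

_<ᵥ_ : ∀ {n k} → Vertex n k → Vertex n k → Set
a <ᵥ b = (a ≤ᵥ b) × (a ≢ b)

_≤ᵥ?_ : ∀ {n k} (a b : Vertex n k) → Dec (a ≤ᵥ b)
_≤ᵥ?_ = PW.decidable FinP._≤?_

_≟ᵥ_ : ∀ {n k} (a b : Vertex n k) → Dec (a ≡ b)
_≟ᵥ_ = ≡-dec FinP._≟_

L : ℕ → ℕ → ℕ
L n k = (n ∸ 1) * k

record Spine (n k : ℕ) : Set where
  field
    s      : Fin (suc (L n k)) → Vertex n k
    start  : ∀ i → toℕ (lookup (s Fin.zero) i) ≡ 0
    end    : ∀ i → suc (toℕ (lookup (s (fromℕ (L n k))) i)) ≡ n
    incr   : ∀ (i : Fin (L n k)) → s (inject₁ i) <ᵥ s (Fin.suc i)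

-- s^m for a natural number index m (clamped to the last index if m > (n-1)k;
-- only ever used at valid indices).
index : ∀ {N} {A : Set} → (Fin (suc N) → A) → ℕ → A
index f zero = f Fin.zero
index {zero} f (suc m) = f Fin.zero
index {suc N} f (suc m) = index (λ i → f (Fin.suc i)) m

module _ {n k : ℕ} (S : Spine n k) where
  open Spine S

  -- M(v) = min{ i : s^i ≥ v }   (the set contains (n-1)k)
  Mi : Vertex n k → ℕ
  Mi v = foldr (λ i acc → if does (v ≤ᵥ? s i) then toℕ i ⊓ acc else acc)
               (L n k) (allFin (suc (L n k)))

  -- μ(v) = max{ i : s^i ≤ v }   (the set contains 0)
  μ : Vertex n k → ℕ
  μ v = foldr (λ i acc → if does (s i ≤ᵥ? v) then toℕ i ⊔ acc else acc)
              0 (allFin (suc (L n k)))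

  toℤᵥ : Vertex n k → Vec ℤ k
  toℤᵥ v = Vec.map (λ x → ℤ.+ toℕ x) v

  _+ᵥ_ _-ᵥ_ : Vec ℤ k → Vec ℤ k → Vec ℤ k
  _+ᵥ_ = zipWith ℤ._+_
  _-ᵥ_ = zipWith ℤ._-_

  herringbone : Fin (suc (L n k)) → Vertex n k → Vec ℤ k
  herringbone j v with v ≟ᵥ s j
  ... | yes _ = toℤᵥ v
  ... | no _ with any? (λ i → v ≟ᵥ s i)
  ...   | yes (i , _) with toℕ i ℕ.<? toℕ j
  ...     | yes _ = toℤᵥ (index s (suc (toℕ i)))
  ...     | no _  = toℤᵥ (index s (toℕ i ∸ 1))
  herringbone j v | no _ | no _ =
    ((toℤᵥ v +ᵥ (toℤᵥ (index s (suc (μ v))) -ᵥ toℤᵥ (index s (μ v))))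
      -ᵥ (toℤᵥ (index s (Mi v)) -ᵥ toℤᵥ (index s (Mi v ∸ 1))))

-- The spine climbs from weight 0 to weight (n-1)k in (n-1)k strict steps, so each
-- step raises exactly one coordinate by one. At s^j the herringbone map is the
-- identity, and on the other spine vertices it moves one step along the spine.
-- Off the spine, h(v) = v + e_c − e_c' where c is the direction of the step leaving
-- s^μ(v) and c' that of the step entering s^M(v), so a fixed point forces c = c'.
-- But maximality of μ(v) gives v_c ≤ s^μ(v)_c, minimality of M(v) gives
-- v_c ≥ s^M(v)_c, and s^μ(v)_c < s^{μ(v)+1}_c ≤ s^M(v)_c since μ(v) < M(v).
module Submission where

open import Defs
open import Data.Nat as ℕ using (ℕ; suc; zero; _+_; _∸_; _*_; _⊔_; _⊓_; _≤_; _<_; z≤n; s≤s; z<s)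
import Data.Nat.Properties as ℕP
open import Data.Fin as Fin using (Fin; toℕ; fromℕ; fromℕ<; inject₁)
import Data.Fin.Properties as FinP
open import Data.Vec as Vec using (Vec; []; _∷_; lookup; zipWith)
import Data.Vec.Properties as VecP
open import Data.Vec.Relation.Binary.Pointwise.Inductive as PW using ([]; _∷_)
open import Data.Vec.Relation.Binary.Pointwise.Extensional using (ext; extensional⇒inductive)
open import Data.Integer as ℤ using (ℤ; +_)
import Data.Integer.Properties as ℤP
open import Data.Integer.Tactic.RingSolver using (solve-∀)
open import Data.List as List using (List; foldr; allFin)
open import Data.List.Membership.Propositional using (_∈_)
open import Data.List.Membership.Propositional.Properties using (∈-allFin)
open import Data.List.Relation.Unary.Any using (here; there)
open import Data.Bool using (if_then_else_)
open import Data.Product as Product using (_×_; ∃-syntax; _,_; proj₁; proj₂)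
open import Data.Sum using (_⊎_; inj₁; inj₂)
open import Data.Empty using (⊥-elim)
open import Relation.Nullary using (¬_; yes; no; does)
open import Level using (0ℓ)
open import Relation.Unary using (Pred; Decidable)
open import Relation.Binary using (Rel; Transitive)
open import Algebra.Definitions using (Selective)
open import Relation.Binary.PropositionalEquality
  using (_≡_; _≢_; refl; sym; trans; cong; cong₂; subst; subst₂; module ≡-Reasoning)

private
  variable
    n k : ℕ

weight : Vertex n k → ℕ
weight []       = 0
weight (x ∷ xs) = toℕ x + weight xs

≤ᵥ-refl : {x : Vertex n k} → x ≤ᵥ x
≤ᵥ-refl = PW.refl ℕP.≤-refl

≤ᵥ-trans : {x y z : Vertex n k} → x ≤ᵥ y → y ≤ᵥ z → x ≤ᵥ z
≤ᵥ-trans = PW.trans ℕP.≤-trans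

≤ᵥ-fromLookup : {x y : Vertex n k} → (∀ c → lookup x c Fin.≤ lookup y c) → x ≤ᵥ y
≤ᵥ-fromLookup x≤y = extensional⇒inductive (ext x≤y)

weight-mono : {x y : Vertex n k} → x ≤ᵥ y → weight x ≤ weight y
weight-mono []       = z≤n
weight-mono (p ∷ ps) = ℕP.+-mono-≤ p (weight-mono ps)

weight-strict : {x y : Vertex n k} → x <ᵥ y → weight x < weight y
weight-strict ([] , x≢y) = ⊥-elim (x≢y refl)
weight-strict {x = a ∷ xs} {b ∷ ys} (p ∷ ps , x≢y) with a FinP.≟ b
... | yes refl = ℕP.+-monoʳ-< (toℕ a) (weight-strict (ps , λ xs≡ys → x≢y (cong (a ∷_) xs≡ys)))
... | no a≢b   = ℕP.+-mono-<-≤ (ℕP.≤∧≢⇒< p (λ e → a≢b (FinP.toℕ-injective e))) (weight-mono ps)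

≤ᵥ∧weight≡⇒≡ : {x y : Vertex n k} → x ≤ᵥ y → weight x ≡ weight y → x ≡ y
≤ᵥ∧weight≡⇒≡ {x = x} {y} x≤y wx≡wy with x ≟ᵥ y
... | yes x≡y = x≡y
... | no x≢y  = ⊥-elim (ℕP.<-irrefl wx≡wy (weight-strict (x≤y , x≢y)))

≤ᵥ-antisym : {x y : Vertex n k} → x ≤ᵥ y → y ≤ᵥ x → x ≡ y
≤ᵥ-antisym x≤y y≤x = ≤ᵥ∧weight≡⇒≡ x≤y (ℕP.≤-antisym (weight-mono x≤y) (weight-mono y≤x))

weight-top : (v : Vertex n k) → (∀ c → suc (toℕ (lookup v c)) ≡ n) → weight v ≡ (n ∸ 1) * k
weight-top {n} {zero}  []      _     = sym (ℕP.*-zeroʳ (n ∸ 1))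
weight-top {n} {suc k} (x ∷ v) v≡top =
  trans (cong₂ _+_ (cong ℕ.pred (v≡top Fin.zero)) (weight-top v (λ c → v≡top (Fin.suc c))))
        (sym (ℕP.*-suc (n ∸ 1) k))

record UnitStep (c : Fin k) (x y : Vertex n k) : Set where
  field
    raised    : toℕ (lookup y c) ≡ suc (toℕ (lookup x c))
    unchanged : ∀ d → d ≢ c → lookup y d ≡ lookup x d

+-tight : ∀ {a b c d} → a < b → c ≤ d → b + d ≡ suc (a + c) → b ≡ suc a × d ≡ c
+-tight {a} {b} {c} {d} a<b c≤d b+d≡1+a+c = b≡1+a , d≡c
  where
  b≡1+a : b ≡ suc a
  b≡1+a = ℕP.≤-antisym
    (ℕP.+-cancelʳ-≤ c b (suc a) (subst (b + c ≤_) b+d≡1+a+c (ℕP.+-monoʳ-≤ b c≤d))) a<b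
  d≡c : d ≡ c
  d≡c = ℕP.+-cancelˡ-≡ b d c (trans b+d≡1+a+c (cong (_+ c) (sym b≡1+a)))

unitStep-head : ∀ {a b : Fin n} {xs : Vertex n k} → toℕ b ≡ suc (toℕ a) →
  UnitStep Fin.zero (a ∷ xs) (b ∷ xs)
unitStep-head b≡1+a = record
  { raised    = b≡1+a
  ; unchanged = λ { Fin.zero 0≢0 → ⊥-elim (0≢0 refl) ; (Fin.suc d) _ → refl } }

unitStep-∷ : ∀ {c} {a : Fin n} {xs ys : Vertex n k} → UnitStep c xs ys →
  UnitStep (Fin.suc c) (a ∷ xs) (a ∷ ys)
unitStep-∷ step = record
  { raised    = UnitStep.raised step
  ; unchanged = λ { Fin.zero _ → refl
                  ; (Fin.suc d) d≢c → UnitStep.unchanged step d (λ e → d≢c (cong Fin.suc e)) } }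

weight-suc⇒unitStep : {x y : Vertex n k} → x ≤ᵥ y → weight y ≡ suc (weight x) →
  ∃[ c ] UnitStep c x y
weight-suc⇒unitStep {x = a ∷ xs} {b ∷ ys} (a≤b ∷ xs≤ys) wy≡1+wx with a FinP.≟ b
... | yes refl =
  Product.map Fin.suc unitStep-∷ (weight-suc⇒unitStep xs≤ys (ℕP.+-cancelˡ-≡ (toℕ a) _ _
    (trans wy≡1+wx (sym (ℕP.+-suc (toℕ a) (weight xs))))))
... | no a≢b =
  let (b≡1+a , wys≡wxs) = +-tight (ℕP.≤∧≢⇒< a≤b (λ e → a≢b (FinP.toℕ-injective e)))
                                  (weight-mono xs≤ys) wy≡1+wx
  in Fin.zero , subst (λ zs → UnitStep Fin.zero (a ∷ xs) (b ∷ zs))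
                      (≤ᵥ∧weight≡⇒≡ xs≤ys (sym wys≡wxs)) (unitStep-head b≡1+a)

unitStep-above : ∀ {c} {x y v : Vertex n k} → UnitStep c x y →
  x ≤ᵥ v → toℕ (lookup x c) < toℕ (lookup v c) → y ≤ᵥ v
unitStep-above {c = c} {x} {y} {v} step x≤v x<v = ≤ᵥ-fromLookup y≤v
  where
  y≤v : ∀ d → lookup y d Fin.≤ lookup v d
  y≤v d with d FinP.≟ c
  ... | yes refl = subst (_≤ toℕ (lookup v c)) (sym (UnitStep.raised step)) x<v
  ... | no d≢c   = subst (Fin._≤ lookup v d) (sym (UnitStep.unchanged step d d≢c)) (PW.lookup x≤v d)

unitStep-below : ∀ {c} {x y v : Vertex n k} → UnitStep c x y →
  v ≤ᵥ y → toℕ (lookup v c) < toℕ (lookup y c) → v ≤ᵥ x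
unitStep-below {c = c} {x} {y} {v} step v≤y v<y = ≤ᵥ-fromLookup v≤x
  where
  v≤x : ∀ d → lookup v d Fin.≤ lookup x d
  v≤x d with d FinP.≟ c
  ... | yes refl = ℕP.≤-pred (subst (toℕ (lookup v c) <_) (UnitStep.raised step) v<y)
  ... | no d≢c   = subst (lookup v d Fin.≤_) (UnitStep.unchanged step d d≢c) (PW.lookup v≤y d)

below-parallelStep : ∀ {c} {x y x′ y′ v : Vertex n k} → UnitStep c x y → UnitStep c x′ y′ →
  y ≤ᵥ y′ → x ≤ᵥ v → v ≤ᵥ y′ → ¬ (y ≤ᵥ v) → v ≤ᵥ x′
below-parallelStep {c = c} {x} {y} {x′} {y′} {v} step step′ y≤y′ x≤v v≤y′ y≰v =
  unitStep-below step′ v≤y′ (ℕP.≤-<-trans vc≤xc (ℕP.<-≤-trans xc<yc (PW.lookup y≤y′ c)))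
  where
  vc≤xc : toℕ (lookup v c) ≤ toℕ (lookup x c)
  vc≤xc = ℕP.≮⇒≥ (λ x<v → y≰v (unitStep-above step x≤v x<v))
  xc<yc : toℕ (lookup x c) < toℕ (lookup y c)
  xc<yc = subst (toℕ (lookup x c) <_) (sym (UnitStep.raised step)) ℕP.≤-refl

-- Definitionally toℤᵥ S for any spine S; δ and the displacement below likewise unfold
-- the vector operations of herringbone.
coordsℤ : Vertex n k → Vec ℤ k
coordsℤ = Vec.map (λ x → + toℕ x)

coordsℤ-injective : {x y : Vertex n k} → coordsℤ x ≡ coordsℤ y → x ≡ y
coordsℤ-injective {x = []}     {[]}     _ = refl
coordsℤ-injective {x = a ∷ xs} {b ∷ ys} e =
  cong₂ _∷_ (FinP.toℕ-injective (ℤP.+-injective (VecP.∷-injectiveˡ e)))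
            (coordsℤ-injective (VecP.∷-injectiveʳ e))

δ : Vertex n k → Vertex n k → Vec ℤ k
δ x y = zipWith ℤ._-_ (coordsℤ y) (coordsℤ x)

lookup-δ : (x y : Vertex n k) (c : Fin k) →
  lookup (δ x y) c ≡ + toℕ (lookup y c) ℤ.- + toℕ (lookup x c)
lookup-δ x y c = trans (VecP.lookup-zipWith ℤ._-_ c (coordsℤ y) (coordsℤ x))
  (cong₂ ℤ._-_ (VecP.lookup-map c _ y) (VecP.lookup-map c _ x))

+-−-cancel : ∀ a u w → (a ℤ.+ u) ℤ.- w ≡ a → u ≡ w
+-−-cancel a u w e = ℤP.i-j≡0⇒i≡j u w (begin
  u ℤ.- w                       ≡⟨ regroup a u w ⟩
  ((a ℤ.+ u) ℤ.- w) ℤ.- a       ≡⟨ cong (ℤ._- a) e ⟩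
  a ℤ.- a                       ≡⟨ ℤP.+-inverseʳ a ⟩
  ℤ.0ℤ                          ∎)
  where
  open ≡-Reasoning
  regroup : ∀ a u w → u ℤ.- w ≡ ((a ℤ.+ u) ℤ.- w) ℤ.- a
  regroup = solve-∀

unitSteps-cancel⇒sameDirection : ∀ {c c′} {x y x′ y′ : Vertex n k} (v : Vec ℤ k) →
  UnitStep c x y → UnitStep c′ x′ y′ →
  zipWith ℤ._-_ (zipWith ℤ._+_ v (δ x y)) (δ x′ y′) ≡ v → c′ ≡ c
unitSteps-cancel⇒sameDirection {c = c} {c′} {x} {y} {x′} {y′} v step step′ cancels
  with c′ FinP.≟ c
... | yes c′≡c = c′≡c
... | no c′≢c  = ⊥-elim (ℕP.1+n≢n (trans (sym (UnitStep.raised step)) yc≡xc))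
  where
  δ≡δ′ : lookup (δ x y) c ≡ lookup (δ x′ y′) c
  δ≡δ′ = +-−-cancel (lookup v c) _ _ (begin
    (lookup v c ℤ.+ lookup (δ x y) c) ℤ.- lookup (δ x′ y′) c
      ≡⟨ cong (ℤ._- lookup (δ x′ y′) c) (VecP.lookup-zipWith ℤ._+_ c v (δ x y)) ⟨
    lookup (zipWith ℤ._+_ v (δ x y)) c ℤ.- lookup (δ x′ y′) c
      ≡⟨ VecP.lookup-zipWith ℤ._-_ c (zipWith ℤ._+_ v (δ x y)) (δ x′ y′) ⟨
    lookup (zipWith ℤ._-_ (zipWith ℤ._+_ v (δ x y)) (δ x′ y′)) c
      ≡⟨ cong (λ w → lookup w c) cancels ⟩
    lookup v c ∎)
    where open ≡-Reasoning
  δ′≡0 : lookup (δ x′ y′) c ≡ ℤ.0ℤ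
  δ′≡0 = trans (lookup-δ x′ y′ c)
    (trans (cong (λ z → + toℕ z ℤ.- + toℕ (lookup x′ c)) (UnitStep.unchanged step′ c (λ e → c′≢c (sym e))))
           (ℤP.+-inverseʳ (+ toℕ (lookup x′ c))))
  yc≡xc : toℕ (lookup y c) ≡ toℕ (lookup x c)
  yc≡xc = ℤP.+-injective (ℤP.i-j≡0⇒i≡j _ _ (trans (sym (lookup-δ x y c)) (trans δ≡δ′ δ′≡0)))

module FilteredFold {A : Set} {P : Pred A 0ℓ} (P? : Decidable P) (key : A → ℕ)
                    (_∙_ : ℕ → ℕ → ℕ) where

  fold : ℕ → List A → ℕ
  fold b = foldr (λ i acc → if does (P? i) then key i ∙ acc else acc) b

  fold-attained : Selective _≡_ _∙_ → ∀ b xs →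
    fold b xs ≡ b ⊎ ∃[ i ] P i × key i ≡ fold b xs
  fold-attained sel b List.[]  = inj₁ refl
  fold-attained sel b (x List.∷ xs) with P? x | sel (key x) (fold b xs) | fold-attained sel b xs
  ... | no _  | _       | rest               = rest
  ... | yes p | inj₁ e  | _                  = inj₂ (x , p , sym e)
  ... | yes _ | inj₂ e  | inj₁ r≡b           = inj₁ (trans e r≡b)
  ... | yes _ | inj₂ e  | inj₂ (i , p , i≡r) = inj₂ (i , p , trans i≡r (sym e))

  fold-bound : {_≼_ : Rel ℕ 0ℓ} → Transitive _≼_ →
    (∀ a r → a ≼ (a ∙ r)) → (∀ a r → r ≼ (a ∙ r)) →
    ∀ b xs i → i ∈ xs → P i → key i ≼ fold b xs
  fold-bound trans′ upperˡ upperʳ b (x List.∷ xs) i i∈ Pi with P? x | i∈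
  ... | no ¬Px | here refl  = ⊥-elim (¬Px Pi)
  ... | no _   | there i∈xs = fold-bound trans′ upperˡ upperʳ b xs i i∈xs Pi
  ... | yes _  | here refl  = upperˡ (key x) (fold b xs)
  ... | yes _  | there i∈xs =
    trans′ (fold-bound trans′ upperˡ upperʳ b xs i i∈xs Pi) (upperʳ (key x) (fold b xs))

strictlyIncreasing-squeeze : (f : ℕ → ℕ) (L : ℕ) → (∀ m → m < L → f m < f (suc m)) →
  f L ≤ L → ∀ m → m ≤ L → f m ≡ m
strictlyIncreasing-squeeze f L f-strict fL≤L m m≤L = ℕP.≤-antisym fm≤m (m≤f m m≤L)
  where
  m≤f : ∀ m → m ≤ L → m ≤ f m
  m≤f zero    _   = z≤n
  m≤f (suc m) m<L = ℕP.≤-trans (s≤s (m≤f m (ℕP.<⇒≤ m<L))) (f-strict m m<L)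
  gap : ∀ d m → d + m ≤ L → f m + d ≤ f (d + m)
  gap zero    m _       = ℕP.≤-reflexive (ℕP.+-identityʳ (f m))
  gap (suc d) m 1+d+m≤L = begin
    f m + suc d      ≡⟨ ℕP.+-suc (f m) d ⟩
    suc (f m + d)    ≤⟨ s≤s (gap d m (ℕP.<⇒≤ 1+d+m≤L)) ⟩
    suc (f (d + m))  ≤⟨ f-strict (d + m) 1+d+m≤L ⟩
    f (suc d + m)    ∎
    where open ℕP.≤-Reasoning
  fm≤m : f m ≤ m
  fm≤m = ℕP.+-cancelʳ-≤ (L ∸ m) (f m) m (begin
    f m + (L ∸ m)    ≤⟨ gap (L ∸ m) m (ℕP.≤-reflexive (ℕP.m∸n+n≡m m≤L)) ⟩
    f (L ∸ m + m)    ≡⟨ cong f (ℕP.m∸n+n≡m m≤L) ⟩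
    f L              ≤⟨ fL≤L ⟩
    L                ≡⟨ ℕP.m+[n∸m]≡n m≤L ⟨
    m + (L ∸ m)      ∎)
    where open ℕP.≤-Reasoning

index-toℕ : ∀ {N} {A : Set} (f : Fin (suc N) → A) (i : Fin (suc N)) → index f (toℕ i) ≡ f i
index-toℕ f Fin.zero              = refl
index-toℕ {suc N} f (Fin.suc i) = index-toℕ (λ j → f (Fin.suc j)) i

index-≡ : ∀ {N m} {A : Set} (f : Fin (suc N) → A) (i : Fin (suc N)) → toℕ i ≡ m → index f m ≡ f i
index-≡ f i refl = index-toℕ f i

module _ (S : Spine n k) where
  open Spine S

  s[_] : ℕ → Vertex n k
  s[_] = index s

  s[]-fromℕ< : ∀ {m} (m≤L : m ≤ L n k) → s[ m ] ≡ s (fromℕ< (s≤s m≤L))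
  s[]-fromℕ< m≤L = index-≡ s _ (FinP.toℕ-fromℕ< (s≤s m≤L))

  s-step : ∀ m → m < L n k → s[ m ] <ᵥ s[ suc m ]
  s-step m m<L = subst₂ _<ᵥ_
    (sym (index-≡ s (inject₁ i) (trans (FinP.toℕ-inject₁ i) (FinP.toℕ-fromℕ< m<L))))
    (sym (index-≡ s (Fin.suc i) (cong suc (FinP.toℕ-fromℕ< m<L))))
    (incr i)
    where
    i : Fin (L n k)
    i = fromℕ< m<L

  s-pred-≢ : ∀ {m} → 0 < m → m ≤ L n k → s[ m ∸ 1 ] ≢ s[ m ]
  s-pred-≢ {suc m} _ m<L = proj₂ (s-step m m<L)

  s-mono : ∀ {m m′} → m ≤ m′ → m′ ≤ L n k → s[ m ] ≤ᵥ s[ m′ ]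
  s-mono {m′ = zero}   z≤n _ = ≤ᵥ-refl
  s-mono {m′ = suc m′} m≤1+m′ m′<L with ℕP.m≤n⇒m<n∨m≡n m≤1+m′
  ... | inj₁ (s≤s m≤m′) = ≤ᵥ-trans (s-mono m≤m′ (ℕP.<⇒≤ m′<L)) (proj₁ (s-step m′ m′<L))
  ... | inj₂ refl       = ≤ᵥ-refl

  s-first≤ : ∀ v → s Fin.zero ≤ᵥ v
  s-first≤ v = ≤ᵥ-fromLookup (λ c → subst (_≤ toℕ (lookup v c)) (sym (start c)) z≤n)

  ≤s-last : ∀ v → v ≤ᵥ s (fromℕ (L n k))
  ≤s-last v = ≤ᵥ-fromLookup (λ c →
    ℕP.≤-pred (subst (suc (toℕ (lookup v c)) ≤_) (sym (end c)) (FinP.toℕ<n (lookup v c))))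

  weight-s : ∀ m → m ≤ L n k → weight s[ m ] ≡ m
  weight-s = strictlyIncreasing-squeeze (λ m → weight s[ m ]) (L n k)
    (λ m m<L → weight-strict (s-step m m<L))
    (ℕP.≤-reflexive (trans (cong weight (index-≡ s _ (FinP.toℕ-fromℕ (L n k))))
                           (weight-top (s (fromℕ (L n k))) end)))

  s-unitStep : ∀ m → m < L n k → ∃[ c ] UnitStep c s[ m ] s[ suc m ]
  s-unitStep m m<L = weight-suc⇒unitStep (proj₁ (s-step m m<L))
    (trans (weight-s (suc m) m<L) (cong suc (sym (weight-s m (ℕP.<⇒≤ m<L)))))

  no-fixedPoint-in-gap : ∀ {v a M} → a < M → M ≤ L n k → s[ a ] ≤ᵥ v → v ≤ᵥ s[ M ] →
    ¬ (s[ suc a ] ≤ᵥ v) → ¬ (v ≤ᵥ s[ M ∸ 1 ]) →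
    zipWith ℤ._-_ (zipWith ℤ._+_ (coordsℤ v) (δ s[ a ] s[ suc a ])) (δ s[ M ∸ 1 ] s[ M ])
      ≢ coordsℤ v
  no-fixedPoint-in-gap {v} {a} {suc m} (s≤s a≤m) m<L s[a]≤v v≤s[M] s[1+a]≰v v≰s[m] fixed
    with s-unitStep a (ℕP.≤-<-trans a≤m m<L) | s-unitStep m m<L
  ... | c , step-a | c′ , step-m
    with unitSteps-cancel⇒sameDirection (coordsℤ v) step-a step-m fixed
  ... | refl = v≰s[m] (below-parallelStep step-a step-m (s-mono (s≤s a≤m) m<L) s[a]≤v v≤s[M] s[1+a]≰v)

  module _ (v : Vertex n k) where
    private
      module Fμ = FilteredFold (λ i → s i ≤ᵥ? v) toℕ _⊔_
      module FM = FilteredFold (λ i → v ≤ᵥ? s i) toℕ _⊓_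

    μ-attained : ∃[ i ] s i ≤ᵥ v × toℕ i ≡ μ S v
    μ-attained with Fμ.fold-attained ℕP.⊔-sel 0 (allFin _)
    ... | inj₁ μ≡0     = Fin.zero , s-first≤ v , sym μ≡0
    ... | inj₂ attained = attained

    M-attained : ∃[ i ] v ≤ᵥ s i × toℕ i ≡ Mi S v
    M-attained with FM.fold-attained ℕP.⊓-sel (L n k) (allFin _)
    ... | inj₁ M≡L     = fromℕ (L n k) , ≤s-last v , trans (FinP.toℕ-fromℕ (L n k)) (sym M≡L)
    ... | inj₂ attained = attained

    μ≤L : μ S v ≤ L n k
    μ≤L = let (i , _ , i≡μ) = μ-attained in subst (_≤ L n k) i≡μ (FinP.toℕ≤pred[n] i)

    M≤L : Mi S v ≤ L n k
    M≤L = let (i , _ , i≡M) = M-attained in subst (_≤ L n k) i≡M (FinP.toℕ≤pred[n] i)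

    s[μ]≤v : s[ μ S v ] ≤ᵥ v
    s[μ]≤v = let (i , si≤v , i≡μ) = μ-attained in subst (_≤ᵥ v) (sym (index-≡ s i i≡μ)) si≤v

    s[M]≡s : ∃[ i ] s[ Mi S v ] ≡ s i
    s[M]≡s = let (i , _ , i≡M) = M-attained in i , index-≡ s i i≡M

    v≤s[M] : v ≤ᵥ s[ Mi S v ]
    v≤s[M] = let (i , v≤si , i≡M) = M-attained in subst (v ≤ᵥ_) (sym (index-≡ s i i≡M)) v≤si

    μ-maximal : ∀ {m} → m ≤ L n k → s[ m ] ≤ᵥ v → m ≤ μ S v
    μ-maximal m≤L s[m]≤v = subst (_≤ μ S v) (FinP.toℕ-fromℕ< (s≤s m≤L))
      (Fμ.fold-bound ℕP.≤-trans ℕP.m≤m⊔n ℕP.m≤n⊔m 0 (allFin _) _ (∈-allFin _)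
        (subst (_≤ᵥ v) (s[]-fromℕ< m≤L) s[m]≤v))

    M-minimal : ∀ {m} → m ≤ L n k → v ≤ᵥ s[ m ] → Mi S v ≤ m
    M-minimal m≤L v≤s[m] = subst (Mi S v ≤_) (FinP.toℕ-fromℕ< (s≤s m≤L))
      (FM.fold-bound (λ p q → ℕP.≤-trans q p) ℕP.m⊓n≤m ℕP.m⊓n≤n (L n k) (allFin _) _ (∈-allFin _)
        (subst (v ≤ᵥ_) (s[]-fromℕ< m≤L) v≤s[m]))

    offSpine⇒μ<M : (∀ i → v ≢ s i) → μ S v < Mi S v
    offSpine⇒μ<M off = ℕP.≰⇒> λ M≤μ →
      let (i , s[M]≡si) = s[M]≡s in
      off i (trans (≤ᵥ-antisym v≤s[M] (≤ᵥ-trans (s-mono M≤μ μ≤L) s[μ]≤v)) s[M]≡si)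

    offSpine-notFixed : (∀ i → v ≢ s i) →
      zipWith ℤ._-_ (zipWith ℤ._+_ (coordsℤ v) (δ s[ μ S v ] s[ suc (μ S v) ]))
                    (δ s[ Mi S v ∸ 1 ] s[ Mi S v ])
        ≢ coordsℤ v
    offSpine-notFixed off = no-fixedPoint-in-gap μ<M M≤L s[μ]≤v v≤s[M]
      (λ s[1+μ]≤v → ℕP.1+n≰n (μ-maximal (ℕP.<-≤-trans μ<M M≤L) s[1+μ]≤v))
      (λ v≤s[M-1] → ℕP.<⇒≱ (ℕP.∸-monoʳ-< z<s (ℕP.≤-<-trans z≤n μ<M))
                           (M-minimal (ℕP.≤-trans (ℕP.m∸n≤m (Mi S v) 1) M≤L) v≤s[M-1]))
      where
      μ<M : μ S v < Mi S v
      μ<M = offSpine⇒μ<M off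

  herringbone-fixes-s : (j : Fin (suc (L n k))) → herringbone S j (s j) ≡ toℤᵥ S (s j)
  herringbone-fixes-s j with s j ≟ᵥ s j
  ... | yes _    = refl
  ... | no sj≢sj = ⊥-elim (sj≢sj refl)

  herringbone-fixed⇒≡s : (j : Fin (suc (L n k))) (v : Vertex n k) →
    herringbone S j v ≡ toℤᵥ S v → v ≡ s j
  herringbone-fixed⇒≡s j v fixed with v ≟ᵥ s j
  ... | yes v≡sj = v≡sj
  ... | no v≢sj with FinP.any? (λ i → v ≟ᵥ s i)
  ...   | yes (i , v≡si) with toℕ i ℕP.<? toℕ j
  ...     | yes i<j = ⊥-elim (proj₂ (s-step (toℕ i) (ℕP.<-≤-trans i<j (FinP.toℕ≤pred[n] j)))
                        (sym (trans (coordsℤ-injective fixed) (trans v≡si (sym (index-toℕ s i))))))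
  ...     | no i≮j  = ⊥-elim (s-pred-≢ (ℕP.≤-<-trans z≤n j<i) (FinP.toℕ≤pred[n] i)
                        (trans (coordsℤ-injective fixed) (trans v≡si (sym (index-toℕ s i)))))
    where
    j<i : toℕ j < toℕ i
    j<i = ℕP.≤∧≢⇒< (ℕP.≮⇒≥ i≮j) (λ j≡i → v≢sj (trans v≡si (cong s (FinP.toℕ-injective (sym j≡i)))))
  herringbone-fixed⇒≡s j v fixed | no _ | no off =
    ⊥-elim (offSpine-notFixed v (λ i v≡si → off (i , v≡si)) fixed)

lemma2 : (n k : ℕ) (S : Spine n k) (j : Fin (suc (L n k))) →
    (herringbone S j (Spine.s S j) ≡ toℤᵥ S (Spine.s S j))
    × ((v : Vertex n k) → herringbone S j v ≡ toℤᵥ S v → v ≡ Spine.s S j)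
lemma2 n k S j = herringbone-fixes-s S j , herringbone-fixed⇒≡s S j
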